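{- Let $D$ be a minimal obstruction. Then the underlying multigraph of $D$ is 2-vertex-connected. Furthermore, $D$ is oriented, acyclic and transitively reduced.
   Context: Digraphs may have loops and multiple edges. A bond is an inclusion-minimal nonempty edge cut $D[X,Y]$; it is directed if all its edges go from $X$ to $Y$. An odd dijoin is a set $J$ of edges meeting every directed bond in an odd number of edges. Contracting an edge set $A$: delete $A$ and identify each weak component of $D[A]$ to a vertex. A non-loop edge $(x,y)$ is deletable if there is a directed $x$–$y$ path avoiding it. A cut minor is obtained by a finite sequence of edge contractions, deletions of deletable edges and deletions of isolated vertices; proper if different from $D$. A minimal obstruction is a digraph without an odd dijoin every proper cut minor of which has an odd dijoin. $D$ is oriented if it has no loops, parallel or antiparallel edges, and transitively reduced if it has no deletable edge. -}

module Defs where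

open import Data.Nat using (ℕ; zero; suc; _+_; _<_; _%_)
open import Data.Fin using (Fin)
import Data.Fin as F
open import Data.Bool using (Bool; true; false; T; not; _∧_; _xor_; if_then_else_)
open import Data.Product using (Σ; ∃; _×_; _,_)
open import Data.Sum using (_⊎_)
open import Data.Unit using (⊤)
open import Relation.Nullary using (¬_)
open import Relation.Binary.PropositionalEquality using (_≡_; _≢_)
open import Relation.Binary.Construct.Closure.ReflexiveTransitive using (Star)
open import Function.Bundles using (_⤖_; Bijection)
open import Function.Definitions using (Injective)

record Digraph : Set where
  field
    nV nE : ℕ
    tail head : Fin nE → Fin nV

open Digraph public

V : Digraph → Set
V D = Fin (nV D)

E : Digraph → Set
E D = Fin (nE D)

count : ∀ {m} → (Fin m → Bool) → ℕ
count {zero}  f = 0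
count {suc m} f = (if f F.zero then 1 else 0) + count (λ i → f (F.suc i))

Odd : ℕ → Set
Odd k = k % 2 ≡ 1

data UWalk (D : Digraph) (ok : E D → Set) : V D → V D → Set where
  nil : ∀ {u} → UWalk D ok u u
  fwd : ∀ {w} (e : E D) → ok e → UWalk D ok (head D e) w → UWalk D ok (tail D e) w
  bwd : ∀ {w} (e : E D) → ok e → UWalk D ok (tail D e) w → UWalk D ok (head D e) w

data DWalk (D : Digraph) (ok : E D → Set) : V D → V D → Set where
  nil  : ∀ {u} → DWalk D ok u u
  step : ∀ {w} (e : E D) → ok e → DWalk D ok (head D e) w → DWalk D ok (tail D e) w

EdgeSet : Digraph → Set
EdgeSet D = E D → Bool

_⊆E_ : ∀ {D} → EdgeSet D → EdgeSet D → Set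
_⊆E_ {D} F G = ∀ (e : E D) → T (F e) → T (G e)

NonemptyE : ∀ {D} → EdgeSet D → Set
NonemptyE {D} F = Σ (E D) λ e → T (F e)

cut : (D : Digraph) → (V D → Bool) → EdgeSet D
cut D X e = X (tail D e) xor X (head D e)

IsCut : (D : Digraph) → EdgeSet D → Set
IsCut D F = Σ (V D → Bool) λ X → ∀ e → F e ≡ cut D X e

IsBond : (D : Digraph) → EdgeSet D → Set
IsBond D F = IsCut D F × NonemptyE {D} F ×
  (∀ (G : EdgeSet D) → IsCut D G → NonemptyE {D} G → _⊆E_ {D} G F → _⊆E_ {D} F G)

DirectedBond : (D : Digraph) → (V D → Bool) → Set
DirectedBond D X = IsBond D (cut D X) ×
  (∀ e → T (cut D X e) → T (X (tail D e)) × T (not (X (head D e))))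

OddDijoin : (D : Digraph) → EdgeSet D → Set
OddDijoin D J = ∀ (X : V D → Bool) → DirectedBond D X →
  Odd (count (λ e → J e ∧ cut D X e))

HasOddDijoin : Digraph → Set
HasOddDijoin D = Σ (EdgeSet D) λ J → OddDijoin D J

Deletable : (D : Digraph) → E D → Set
Deletable D e = tail D e ≢ head D e × DWalk D (λ f → f ≢ e) (tail D e) (head D e)

-- Isomorphism and cut-minor operations (results are determined up to
-- isomorphism, so each operation is a relation between D and D').

record Iso (D D' : Digraph) : Set where
  field
    φ : V D ⤖ V D'
    ψ : E D ⤖ E D'
    tail-comm : ∀ e → tail D' (Bijection.to ψ e) ≡ Bijection.to φ (tail D e)
    head-comm : ∀ e → head D' (Bijection.to ψ e) ≡ Bijection.to φ (head D e)

-- D' is obtained from D by contracting the edge set A: delete A and identify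
-- each weak component of D[A] (spanning subgraph with edge set A) to a vertex.
record Contraction (D : Digraph) (A : EdgeSet D) (D' : Digraph) : Set where
  field
    φ      : V D → V D'
    φ-surj : ∀ x → Σ (V D) λ u → φ u ≡ x
    φ-ker₁ : ∀ u v → φ u ≡ φ v → UWalk D (λ e → T (A e)) u v
    φ-ker₂ : ∀ u v → UWalk D (λ e → T (A e)) u v → φ u ≡ φ v
    ψ      : E D' → E D
    ψ-inj  : Injective _≡_ _≡_ ψ
    ψ-out  : ∀ e' → T (not (A (ψ e')))
    ψ-onto : ∀ e → T (not (A e)) → Σ (E D') λ e' → ψ e' ≡ e
    tail-comm : ∀ e' → tail D' e' ≡ φ (tail D (ψ e'))
    head-comm : ∀ e' → head D' e' ≡ φ (head D (ψ e'))

record DeleteEdge (D : Digraph) (e : E D) (D' : Digraph) : Set where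
  field
    deletable : Deletable D e
    φ      : V D ⤖ V D'
    ψ      : E D' → E D
    ψ-inj  : Injective _≡_ _≡_ ψ
    ψ-out  : ∀ e' → ψ e' ≢ e
    ψ-onto : ∀ f → f ≢ e → Σ (E D') λ e' → ψ e' ≡ f
    tail-comm : ∀ e' → tail D' e' ≡ Bijection.to φ (tail D (ψ e'))
    head-comm : ∀ e' → head D' e' ≡ Bijection.to φ (head D (ψ e'))

Isolated : (D : Digraph) → V D → Set
Isolated D v = ∀ e → tail D e ≢ v × head D e ≢ v

record DeleteVertex (D : Digraph) (v : V D) (D' : Digraph) : Set where
  field
    isolated : Isolated D v
    φ      : V D' → V D
    φ-inj  : Injective _≡_ _≡_ φ
    φ-out  : ∀ x → φ x ≢ v
    φ-onto : ∀ u → u ≢ v → Σ (V D') λ x → φ x ≡ u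
    ψ      : E D' ⤖ E D
    tail-comm : ∀ e' → tail D (Bijection.to ψ e') ≡ φ (tail D' e')
    head-comm : ∀ e' → head D (Bijection.to ψ e') ≡ φ (head D' e')

CutMinorStep : Digraph → Digraph → Set
CutMinorStep D D' =
  (Σ (EdgeSet D) λ A → Contraction D A D') ⊎
  (Σ (E D) λ e → DeleteEdge D e D') ⊎
  (Σ (V D) λ v → DeleteVertex D v D')

CutMinor : Digraph → Digraph → Set
CutMinor = Star CutMinorStep

ProperCutMinor : Digraph → Digraph → Set
ProperCutMinor D D' = CutMinor D D' × ¬ Iso D D'

MinimalObstruction : Digraph → Set
MinimalObstruction D = ¬ HasOddDijoin D ×
  (∀ D' → ProperCutMinor D D' → HasOddDijoin D')

Connected : Digraph → Set
Connected D = ∀ (u w : V D) → UWalk D (λ _ → ⊤) u w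

TwoVertexConnected : Digraph → Set
TwoVertexConnected D = 2 < nV D × Connected D ×
  (∀ (v u w : V D) → u ≢ v → w ≢ v →
     UWalk D (λ e → tail D e ≢ v × head D e ≢ v) u w)

Oriented : Digraph → Set
Oriented D =
  (∀ e → tail D e ≢ head D e) ×
  (∀ e f → e ≢ f → ¬ (tail D e ≡ tail D f × head D e ≡ head D f)) ×
  (∀ e f → ¬ (tail D e ≡ head D f × head D e ≡ tail D f))

Acyclic : Digraph → Set
Acyclic D = ∀ e → ¬ DWalk D (λ _ → ⊤) (head D e) (tail D e)

TransitivelyReduced : Digraph → Set
TransitivelyReduced D = ∀ e → ¬ Deletable D e

-- If D' arises by contracting an edge set A,
-- deleting a deletable edge or deleting an isolated vertex, then a directed bond of D that
-- survives in D' (for a contraction: one avoiding A) is still a directed bond of D', so the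
-- odd dijoin of D', read back in D, meets it oddly. Hence every edge of D lies in a directed
-- bond, which rules out loops, 2-cycles and directed cycles; no edge is deletable, which rules
-- out parallel edges; and no vertex is isolated. A separation at a vertex p splits the edges
-- into two nonempty classes such that every directed bond avoids one of them, and gluing the
-- odd sets obtained by contracting either class gives an odd dijoin of D. Finally an oriented
-- digraph on at most two vertices has at most one edge and so has an odd dijoin.

module Submission where

import Algebra.Properties.CommutativeSemigroup as CommSemigroupProperties
open import Defs
open import Data.Bool using (Bool; true; false; T; not; _∧_; _∨_; _xor_; if_then_else_)
open import Data.Bool.Properties using (T-≡; ¬-not; xor-same; ∧-zeroʳ; ∨-zeroʳ)
  renaming (_≟_ to _≟B_)
open import Data.Empty using (⊥; ⊥-elim)
open import Data.Fin using (Fin; punchIn; punchOut)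
import Data.Fin as F
import Data.Fin.Properties as FinP
open import Data.Fin.Properties
  using (punchIn-injective; punchInᵢ≢i; punchOut-cong; punchIn-punchOut; punchOut-punchIn;
         pigeonhole; any?; suc-injective)
  renaming (_≟_ to _≟F_)
open import Data.Nat using (ℕ; zero; suc; _+_; _<_; _≤_; _<?_; z≤n; s≤s)
open import Data.Nat.Properties
  using (+-commutativeSemigroup; +-suc; +-identityʳ; +-mono-≤; ≤-refl; ≤-trans; m≤n⇒m≤1+n; m≤n+m; ≤⇒≯; ≮⇒≥)
open import Data.Product using (Σ; _×_; _,_; proj₁; proj₂)
open import Data.Sum using (_⊎_; inj₁; inj₂)
open import Data.Unit using (⊤; tt)
open import Function.Bundles using (Bijection; Equivalence)
open import Function.Construct.Identity using (⤖-id)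
open import Function.Definitions using (Injective)
open import Relation.Binary.Construct.Closure.ReflexiveTransitive using (ε; _◅_)
open import Relation.Binary.PropositionalEquality
  using (_≡_; _≢_; refl; sym; trans; cong; cong₂; subst; subst₂)
open import Relation.Nullary using (¬_; yes; no; does)
open import Relation.Nullary.Decidable using (dec-true; dec-false)
open import Relation.Nullary.Decidable.Core using (_×-dec_; _⊎-dec_)

T⇒≡ : ∀ {b} → T b → b ≡ true
T⇒≡ = Equivalence.to T-≡

≡⇒T : ∀ {b} → b ≡ true → T b
≡⇒T = Equivalence.from T-≡

¬T⇒≡false : ∀ {b} → ¬ T b → b ≡ false
¬T⇒≡false {true}  ¬b = ⊥-elim (¬b tt)
¬T⇒≡false {false} _  = refl

T-not⇒≡false : ∀ {b} → T (not b) → b ≡ false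
T-not⇒≡false {false} _ = refl

true≢false : true ≢ false
true≢false ()

∧-true-left : ∀ a {b} → a ∧ b ≡ true → a ≡ true
∧-true-left true _ = refl

∧-true-right : ∀ a {b} → a ∧ b ≡ true → b ≡ true
∧-true-right true p = p

∨-true-right : ∀ a {b} → b ≡ true → a ∨ b ≡ true
∨-true-right false p = p
∨-true-right true  _ = refl

∨-true-left : ∀ a {b} → a ∨ b ≡ true → b ≡ false → a ≡ true
∨-true-left true  _ _ = refl
∨-true-left false p q = ⊥-elim (true≢false (trans (sym p) q))

∨-false : ∀ a {b} → a ∨ b ≡ false → a ≡ false × b ≡ false
∨-false false p = refl , p

xor≡false⇒≡ : ∀ a b → a xor b ≡ false → a ≡ b
xor≡false⇒≡ false false _ = refl
xor≡false⇒≡ true  true  _ = refl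

≢⇒xor≡true : ∀ a b → a ≢ b → a xor b ≡ true
≢⇒xor≡true false false p = ⊥-elim (p refl)
≢⇒xor≡true false true  _ = refl
≢⇒xor≡true true  false _ = refl
≢⇒xor≡true true  true  p = ⊥-elim (p refl)

xor≡true⇒≢ : ∀ a b → a xor b ≡ true → a ≢ b
xor≡true⇒≢ false false () _
xor≡true⇒≢ true  true  () _

_==_ : ∀ {n} → Fin n → Fin n → Bool
i == j = does (i ≟F j)

==⇒≡ : ∀ {n} (i j : Fin n) → i == j ≡ true → i ≡ j
==⇒≡ i j p with i ≟F j
... | yes i≡j = i≡j

==-refl : ∀ {n} (i : Fin n) → i == i ≡ true
==-refl i = dec-true (i ≟F i) refl

≢⇒==false : ∀ {n} (i j : Fin n) → i ≢ j → i == j ≡ false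
≢⇒==false i j = dec-false (i ≟F j)

anyFin : ∀ {m} → (Fin m → Bool) → Bool
anyFin {zero}  f = false
anyFin {suc m} f = f F.zero ∨ anyFin (λ i → f (F.suc i))

anyFin-witness : ∀ {m} (f : Fin m → Bool) → anyFin f ≡ true → Σ (Fin m) λ i → f i ≡ true
anyFin-witness {suc m} f p with f F.zero in f0
... | true  = F.zero , f0
... | false with anyFin-witness (λ i → f (F.suc i)) p
...   | i , q = F.suc i , q

anyFin-intro : ∀ {m} (f : Fin m → Bool) i → f i ≡ true → anyFin f ≡ true
anyFin-intro f F.zero    p rewrite p = refl
anyFin-intro f (F.suc i) p = ∨-true-right (f F.zero) (anyFin-intro (λ i → f (F.suc i)) i p)

bit : Bool → ℕ
bit b = if b then 1 else 0

count-cong : ∀ {m} (f g : Fin m → Bool) → (∀ i → f i ≡ g i) → count f ≡ count g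
count-cong {zero}  f g f≗g = refl
count-cong {suc m} f g f≗g =
  cong₂ _+_ (cong bit (f≗g F.zero)) (count-cong (λ i → f (F.suc i)) (λ i → g (F.suc i)) (λ i → f≗g (F.suc i)))

count-empty : ∀ {m} (f : Fin m → Bool) → (∀ i → f i ≡ false) → count f ≡ 0
count-empty {zero}  f empty = refl
count-empty {suc m} f empty rewrite empty F.zero = count-empty (λ i → f (F.suc i)) (λ i → empty (F.suc i))

_without_ : ∀ {m} → (Fin m → Bool) → Fin m → Fin m → Bool
(g without j) i = if i == j then false else g i

count-without : ∀ {m} (g : Fin m → Bool) (j : Fin m) → count g ≡ bit (g j) + count (g without j)
count-without {suc m} g F.zero    = refl
count-without {suc m} g (F.suc j) =
  trans (cong (bit (g F.zero) +_) (count-without (λ i → g (F.suc i)) j))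
        (x∙yz≈y∙xz (bit (g F.zero)) (bit (g (F.suc j))) (count ((λ i → g (F.suc i)) without j)))
  where open CommSemigroupProperties +-commutativeSemigroup using (x∙yz≈y∙xz)

count-reindex : ∀ {n m} (ψ : Fin n → Fin m) → Injective _≡_ _≡_ ψ → (g : Fin m → Bool) →
  (∀ e → g e ≡ true → Σ (Fin n) λ i → ψ i ≡ e) → count g ≡ count (λ i → g (ψ i))
count-reindex {zero} ψ ψ-inj g supp = count-empty g λ e → ¬T⇒≡false λ ge → noFin (proj₁ (supp e (T⇒≡ ge)))
  where
  noFin : Fin 0 → ⊥
  noFin ()
count-reindex {suc n} ψ ψ-inj g supp =
  trans (count-without g (ψ F.zero))
    (cong (bit (g (ψ F.zero)) +_)
      (trans (count-reindex ψ⁺ (λ p → suc-injective (ψ-inj p)) (g without ψ F.zero) supp⁺)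
             (count-cong _ _ λ i → cong (λ b → if b then false else g (ψ⁺ i))
                (≢⇒==false (ψ⁺ i) (ψ F.zero) λ q → 0≢suc (ψ-inj (sym q))))))
  where
  ψ⁺ : Fin n → _
  ψ⁺ i = ψ (F.suc i)
  0≢suc : ∀ {i : Fin n} → F.zero ≢ F.suc i
  0≢suc ()
  supp⁺ : ∀ e → (g without ψ F.zero) e ≡ true → Σ (Fin n) λ i → ψ⁺ i ≡ e
  supp⁺ e p with e == ψ F.zero in e≟ψ0
  ... | false with supp e p
  ...   | F.zero  , ψ0≡e = ⊥-elim (true≢false (trans (sym (==-refl e)) (trans (cong (e ==_) (sym ψ0≡e)) e≟ψ0)))
  ...   | F.suc i , ψi≡e = i , ψi≡e

pushforward : ∀ {n m} → (Fin n → Fin m) → (Fin n → Bool) → Fin m → Bool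
pushforward ψ J e = anyFin λ i → J i ∧ (ψ i == e)

pushforward-image : ∀ {n m} (ψ : Fin n → Fin m) → Injective _≡_ _≡_ ψ → ∀ J i → pushforward ψ J (ψ i) ≡ J i
pushforward-image ψ ψ-inj J i with J i in Ji
... | true  = anyFin-intro _ i (subst (λ b → b ∧ (ψ i == ψ i) ≡ true) (sym Ji) (==-refl (ψ i)))
... | false with anyFin (λ k → J k ∧ (ψ k == ψ i)) in any
...   | false = refl
...   | true with anyFin-witness _ any
...     | k , p = ⊥-elim (true≢false (trans (sym (∧-true-left (J k) p))
                    (subst (λ l → J l ≡ false) (sym (ψ-inj (==⇒≡ _ _ (∧-true-right (J k) p)))) Ji)))

pushforward-support : ∀ {n m} (ψ : Fin n → Fin m) J e → pushforward ψ J e ≡ true → Σ (Fin n) λ i → ψ i ≡ e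
pushforward-support ψ J e p with anyFin-witness _ p
... | i , q = i , ==⇒≡ _ _ (∧-true-right (J i) q)

count≤ : ∀ {n} (S : Fin n → Bool) → count S ≤ n
count≤ {zero}  S = z≤n
count≤ {suc n} S with S F.zero
... | true  = s≤s (count≤ (λ i → S (F.suc i)))
... | false = m≤n⇒m≤1+n (count≤ (λ i → S (F.suc i)))

bit-mono : ∀ a b → (a ≡ true → b ≡ true) → bit a ≤ bit b
bit-mono false _     _ = z≤n
bit-mono true  true  _ = ≤-refl
bit-mono true  false h = ⊥-elim (true≢false (sym (h refl)))

count-mono : ∀ {n} (S S' : Fin n → Bool) → (∀ z → S z ≡ true → S' z ≡ true) → count S ≤ count S'
count-mono {zero}  S S' S⊆S' = z≤n
count-mono {suc n} S S' S⊆S' = +-mono-≤ (bit-mono _ _ (S⊆S' F.zero)) (count-mono _ _ (λ z → S⊆S' (F.suc z)))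

count-strictMono : ∀ {n} (S S' : Fin n → Bool) → (∀ z → S z ≡ true → S' z ≡ true) →
  ∀ z → S' z ≡ true → S z ≡ false → suc (count S) ≤ count S'
count-strictMono {suc n} S S' S⊆S' F.zero    S'z Sz rewrite S'z | Sz = s≤s (count-mono _ _ (λ z → S⊆S' (F.suc z)))
count-strictMono {suc n} S S' S⊆S' (F.suc z) S'z Sz =
  subst (_≤ count S') (+-suc (bit (S F.zero)) _)
    (+-mono-≤ (bit-mono _ _ (S⊆S' F.zero)) (count-strictMono _ _ (λ z → S⊆S' (F.suc z)) z S'z Sz))

_++ᵘ_ : ∀ {D ok u x y} → UWalk D ok u x → UWalk D ok x y → UWalk D ok u y
nil        ++ᵘ q = q
fwd e p r  ++ᵘ q = fwd e p (r ++ᵘ q)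
bwd e p r  ++ᵘ q = bwd e p (r ++ᵘ q)

uwalk-invariant : ∀ D (ok : E D → Set) {B : Set} (φ : V D → B) → (∀ f → ok f → φ (tail D f) ≡ φ (head D f)) →
  ∀ {u v} → UWalk D ok u v → φ u ≡ φ v
uwalk-invariant D ok φ inv nil            = refl
uwalk-invariant D ok φ inv (fwd f okf w) = trans (inv f okf) (uwalk-invariant D ok φ inv w)
uwalk-invariant D ok φ inv (bwd f okf w) = trans (sym (inv f okf)) (uwalk-invariant D ok φ inv w)

DirectedCut : (D : Digraph) → (V D → Bool) → Set
DirectedCut D X = ∀ e → T (cut D X e) → T (X (tail D e)) × T (not (X (head D e)))

directedCut-closedOutside : ∀ D X → DirectedCut D X → ∀ e → X (tail D e) ≡ false → X (head D e) ≡ false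
directedCut-closedOutside D X dir e Xt with X (head D e) in Xh
... | false = refl
... | true  = ⊥-elim (subst T Xt (proj₁ (dir e (subst T (sym (cong₂ _xor_ Xt Xh)) tt))))

dwalk-staysOutside : ∀ D X (ok : E D → Set) {u w} → DirectedCut D X → DWalk D ok u w → X u ≡ false → X w ≡ false
dwalk-staysOutside D X ok dir nil           Xu = Xu
dwalk-staysOutside D X ok dir (step e _ w) Xu = dwalk-staysOutside D X ok dir w (directedCut-closedOutside D X dir e Xu)

dwalk-leaves : ∀ D (X : V D → Bool) (ok : E D → Set) {u w} → DWalk D ok u w → X u ≡ true → X w ≡ false →
  Σ (E D) λ f → ok f × X (tail D f) ≡ true × X (head D f) ≡ false
dwalk-leaves D X ok nil             Xu Xw = ⊥-elim (true≢false (trans (sym Xu) Xw))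
dwalk-leaves D X ok (step e oke w) Xu Xw with X (head D e) in Xh
... | false = e , oke , Xu , Xh
... | true  = dwalk-leaves D X ok w Xh Xw

-- The walk crosses Z's cut along some edge, which lies in the directed cut of X, so the
-- walk is inside X before that edge and outside X from then on.
dwalk-crossing-subcut : ∀ D (X Z : V D → Bool) (ok : E D → Set) {u w} → DirectedCut D X → DWalk D ok u w →
  (∀ f → ok f → T (cut D Z f) → T (cut D X f)) → Z u ≢ Z w → X u ≡ true × X w ≡ false
dwalk-crossing-subcut D X Z ok dir nil H Zu≢Zw = ⊥-elim (Zu≢Zw refl)
dwalk-crossing-subcut D X Z ok dir (step g okg w) H Zu≢Zw with Z (tail D g) ≟B Z (head D g)
... | no Zt≢Zh =
  let (Xt , ¬Xh) = dir g (H g okg (≡⇒T (≢⇒xor≡true _ _ Zt≢Zh)))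
  in T⇒≡ Xt , dwalk-staysOutside D X ok dir w (T-not⇒≡false ¬Xh)
... | yes Zt≡Zh with dwalk-crossing-subcut D X Z ok dir w H (λ q → Zu≢Zw (trans Zt≡Zh q))
...   | Xh , Xw with X (tail D g) in Xt
...     | true  = refl , Xw
...     | false = ⊥-elim (true≢false (trans (sym Xh) (directedCut-closedOutside D X dir g Xt)))

-- Transporting directed bonds to a cut minor

record BondTransport (D D' : Digraph) (ψ : E D' → E D) (X : V D → Bool) : Set where
  field
    X'         : V D' → Bool
    tail-agree : ∀ e' → X' (tail D' e') ≡ X (tail D (ψ e'))
    head-agree : ∀ e' → X' (head D' e') ≡ X (head D (ψ e'))
    crossing   : Σ (E D') λ e' → T (cut D X (ψ e'))
    lift-subcut : ∀ (Z' : V D' → Bool) → NonemptyE {D'} (cut D' Z') → _⊆E_ {D'} (cut D' Z') (cut D' X') →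
      Σ (V D → Bool) λ Z → _⊆E_ {D} (cut D Z) (cut D X) × (∀ e' → cut D Z (ψ e') ≡ cut D' Z' e')

  cut-agree : ∀ e' → cut D' X' e' ≡ cut D X (ψ e')
  cut-agree e' = cong₂ _xor_ (tail-agree e') (head-agree e')

module _ {D D' : Digraph} {ψ : E D' → E D} {X : V D → Bool} where

  transport-directedBond : DirectedBond D X → (t : BondTransport D D' ψ X) → DirectedBond D' (BondTransport.X' t)
  transport-directedBond ((_ , _ , minimal) , dir) t =
    ((X' , λ _ → refl) , (e₀ , subst T (sym (cut-agree e₀)) ψe₀∈X) , minimal') , dir'
    where
    open BondTransport t
    e₀ = proj₁ crossing
    ψe₀∈X = proj₂ crossing
    minimal' : ∀ G → IsCut D' G → NonemptyE {D'} G → _⊆E_ {D'} G (cut D' X') → _⊆E_ {D'} (cut D' X') G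
    minimal' G (Z' , G≗Z') (g , g∈G) G⊆X' e' e'∈X' =
      let g∈Z'    = subst T (G≗Z' g) g∈G
          Z'⊆X'   = λ f f∈Z' → G⊆X' f (subst T (sym (G≗Z' f)) f∈Z')
          (Z , Z⊆X , Z≗Z') = lift-subcut Z' (g , g∈Z') Z'⊆X'
          X⊆Z     = minimal (cut D Z) (Z , λ _ → refl) (ψ g , subst T (sym (Z≗Z' g)) g∈Z') Z⊆X
      in subst T (sym (G≗Z' e')) (subst T (Z≗Z' e') (X⊆Z (ψ e') (subst T (cut-agree e') e'∈X')))
    dir' : DirectedCut D' X'
    dir' e' e'∈X' = let (Xt , ¬Xh) = dir (ψ e') (subst T (cut-agree e') e'∈X') in
      subst T (sym (tail-agree e')) Xt , subst (λ b → T (not b)) (sym (head-agree e')) ¬Xh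

  transport-odd : Injective _≡_ _≡_ ψ → DirectedBond D X → BondTransport D D' ψ X →
    ∀ J' → OddDijoin D' J' → Odd (count (λ e → pushforward ψ J' e ∧ cut D X e))
  transport-odd ψ-inj db t J' odd' =
    subst Odd (sym same-count) (odd' X' (transport-directedBond db t))
    where
    open BondTransport t
    same-count : count (λ e → pushforward ψ J' e ∧ cut D X e) ≡ count (λ e' → J' e' ∧ cut D' X' e')
    same-count =
      trans (count-reindex ψ ψ-inj _ (λ e p → pushforward-support ψ J' e (∧-true-left (pushforward ψ J' e) p)))
            (count-cong _ _ λ e' → cong₂ _∧_ (pushforward-image ψ ψ-inj J' e') (sym (cut-agree e')))

-- Contracting an edge set

-- A composite of contractions of the edges of A, recorded only through what the parity
-- argument uses.
record ContractionMap (D D' : Digraph) (A : EdgeSet D) : Set where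
  field
    φ         : V D → V D'
    ψ         : E D' → E D
    ψ-inj     : Injective _≡_ _≡_ ψ
    ψ-onto    : ∀ e → A e ≡ false → Σ (E D') λ e' → ψ e' ≡ e
    tail-comm : ∀ e' → tail D' e' ≡ φ (tail D (ψ e'))
    head-comm : ∀ e' → head D' e' ≡ φ (head D (ψ e'))
    collapse  : ∀ e → A e ≡ true → φ (tail D e) ≡ φ (head D e)
    factor    : ∀ (X : V D → Bool) → (∀ e → A e ≡ true → X (tail D e) ≡ X (head D e)) →
      Σ (V D' → Bool) λ X' → ∀ z → X z ≡ X' (φ z)

contraction-transport : ∀ {D D' A} (c : ContractionMap D D' A) → ∀ X → DirectedBond D X →
  (∀ e → A e ≡ true → cut D X e ≡ false) → BondTransport D D' (ContractionMap.ψ c) X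
contraction-transport {D} {D'} {A} c X ((_ , (e₀ , e₀∈X) , _) , _) avoid = record
  { X' = X' ; tail-agree = tail-agree ; head-agree = head-agree ; crossing = crossing ; lift-subcut = lift-subcut }
  where
  open ContractionMap c
  X' = proj₁ (factor X (λ e e∈A → xor≡false⇒≡ _ _ (avoid e e∈A)))
  X≗X'∘φ = proj₂ (factor X (λ e e∈A → xor≡false⇒≡ _ _ (avoid e e∈A)))
  tail-agree : ∀ e' → X' (tail D' e') ≡ X (tail D (ψ e'))
  tail-agree e' = trans (cong X' (tail-comm e')) (sym (X≗X'∘φ _))
  head-agree : ∀ e' → X' (head D' e') ≡ X (head D (ψ e'))
  head-agree e' = trans (cong X' (head-comm e')) (sym (X≗X'∘φ _))
  crossing : Σ (E D') λ e' → T (cut D X (ψ e'))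
  crossing with A e₀ in e₀∈A
  ... | true  = ⊥-elim (subst T (avoid e₀ e₀∈A) e₀∈X)
  ... | false with ψ-onto e₀ e₀∈A
  ...   | e' , refl = e' , e₀∈X
  lift-subcut : ∀ (Z' : V D' → Bool) → NonemptyE {D'} (cut D' Z') → _⊆E_ {D'} (cut D' Z') (cut D' X') →
    Σ (V D → Bool) λ Z → _⊆E_ {D} (cut D Z) (cut D X) × (∀ e' → cut D Z (ψ e') ≡ cut D' Z' e')
  lift-subcut Z' _ Z'⊆X' = (λ z → Z' (φ z)) , Z⊆X , Z≗Z'
    where
    Z≗Z' : ∀ e' → cut D (λ z → Z' (φ z)) (ψ e') ≡ cut D' Z' e'
    Z≗Z' e' = sym (cong₂ _xor_ (cong Z' (tail-comm e')) (cong Z' (head-comm e')))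
    Z⊆X : _⊆E_ {D} (cut D (λ z → Z' (φ z))) (cut D X)
    Z⊆X e e∈Z with A e in e∈A
    ... | true  = ⊥-elim (subst T (trans (cong (λ v → Z' (φ (tail D e)) xor Z' v) (sym (collapse e e∈A)))
                                         (xor-same (Z' (φ (tail D e))))) e∈Z)
    ... | false with ψ-onto e e∈A
    ...   | e' , refl = subst T (cong₂ _xor_ (tail-agree e') (head-agree e')) (Z'⊆X' e' (subst T (Z≗Z' e') e∈Z))

digraph : (n m : ℕ) → (Fin m → Fin n) → (Fin m → Fin n) → Digraph
digraph n m t h = record { nV = n ; nE = m ; tail = t ; head = h }

identify : ∀ {n} (x y : Fin (suc n)) → x ≢ y → Fin (suc n) → Fin n
identify x y x≢y z with z ≟F y
... | yes _   = punchOut {i = y} {j = x} (λ y≡x → x≢y (sym y≡x))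
... | no z≢y  = punchOut {i = y} {j = z} (λ y≡z → z≢y (sym y≡z))

identify-identifies : ∀ {n} (x y : Fin (suc n)) x≢y → identify x y x≢y x ≡ identify x y x≢y y
identify-identifies x y x≢y with x ≟F y | y ≟F y
... | yes x≡y | _       = ⊥-elim (x≢y x≡y)
... | no _    | no y≢y  = ⊥-elim (y≢y refl)
... | no _    | yes _   = punchOut-cong y refl

identify-punchIn : ∀ {n} (x y : Fin (suc n)) x≢y z' → identify x y x≢y (punchIn y z') ≡ z'
identify-punchIn x y x≢y z' with punchIn y z' ≟F y
... | yes p = ⊥-elim (punchInᵢ≢i y z' p)
... | no _  = trans (punchOut-cong y refl) (punchOut-punchIn y)

punchIn-identify : ∀ {n} (x y : Fin (suc n)) x≢y z →
  punchIn y (identify x y x≢y z) ≡ z ⊎ (z ≡ y × punchIn y (identify x y x≢y z) ≡ x)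
punchIn-identify x y x≢y z with z ≟F y
... | yes z≡y = inj₂ (z≡y , punchIn-punchOut _)
... | no _    = inj₁ (punchIn-punchOut _)

punchIn-covers : ∀ {m} (e f : Fin (suc m)) → f ≢ e → Σ (Fin m) λ i → punchIn e i ≡ f
punchIn-covers e f f≢e = punchOut {i = e} {j = f} (λ e≡f → f≢e (sym e≡f)) , punchIn-punchOut _

≢⇒T-not-== : ∀ {m} (f e : Fin m) → f ≢ e → T (not (f == e))
≢⇒T-not-== f e f≢e rewrite ≢⇒==false f e f≢e = tt

T-not-==⇒≢ : ∀ {m} (f e : Fin m) → T (not (f == e)) → f ≢ e
T-not-==⇒≢ f e p refl = subst (λ b → T (not b)) (==-refl f) p

singleton : ∀ {m} → Fin m → Fin m → Bool
singleton e f = f == e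

record EdgeContraction (n m : ℕ) (t h : Fin (suc m) → Fin n) (e : Fin (suc m)) : Set where
  field
    n′       : ℕ
    φ        : Fin n → Fin n′
    contraction : Contraction (digraph n (suc m) t h) (singleton e)
                    (digraph n′ m (λ i → φ (t (punchIn e i))) (λ i → φ (h (punchIn e i))))
    collapse : φ (t e) ≡ φ (h e)
    factor   : ∀ (X : Fin n → Bool) → X (t e) ≡ X (h e) → Σ (Fin n′ → Bool) λ X' → ∀ z → X z ≡ X' (φ z)

contract-edge : ∀ n m (t h : Fin (suc m) → Fin n) e → EdgeContraction n m t h e
contract-edge n m t h e with t e ≟F h e
... | yes loop = record
  { n′ = n ; φ = λ z → z ; collapse = loop ; factor = λ X _ → X , λ _ → refl
  ; contraction = record
    { φ = λ z → z ; φ-surj = λ x → x , refl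
    ; φ-ker₁ = λ { u v refl → nil }
    ; φ-ker₂ = λ u v → uwalk-invariant D _ (λ z → z) λ f f∈e → subst (λ g → t g ≡ h g) (sym (==⇒≡ f e (T⇒≡ f∈e))) loop
    ; ψ = punchIn e ; ψ-inj = punchIn-injective e _ _
    ; ψ-out = λ i → ≢⇒T-not-== (punchIn e i) e (punchInᵢ≢i e i)
    ; ψ-onto = λ f f∉e → punchIn-covers e f (T-not-==⇒≢ f e f∉e)
    ; tail-comm = λ _ → refl ; head-comm = λ _ → refl } }
  where
  D = digraph n (suc m) t h
contract-edge zero m t h e | no _ with t e
... | ()
contract-edge (suc n) m t h e | no x≢y = record
  { n′ = n ; φ = φ ; collapse = identify-identifies x y x≢y ; factor = factor
  ; contraction = record
    { φ = φ ; φ-surj = λ z' → punchIn y z' , identify-punchIn x y x≢y z'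
    ; φ-ker₁ = φ-ker
    ; φ-ker₂ = λ u v → uwalk-invariant D _ φ λ f f∈e →
        subst (λ g → φ (t g) ≡ φ (h g)) (sym (==⇒≡ f e (T⇒≡ f∈e))) (identify-identifies x y x≢y)
    ; ψ = punchIn e ; ψ-inj = punchIn-injective e _ _
    ; ψ-out = λ i → ≢⇒T-not-== (punchIn e i) e (punchInᵢ≢i e i)
    ; ψ-onto = λ f f∉e → punchIn-covers e f (T-not-==⇒≢ f e f∉e)
    ; tail-comm = λ _ → refl ; head-comm = λ _ → refl } }
  where
  D = digraph (suc n) (suc m) t h
  x = t e
  y = h e
  φ = identify x y x≢y
  factor : ∀ (X : Fin (suc n) → Bool) → X x ≡ X y → Σ (Fin n → Bool) λ X' → ∀ z → X z ≡ X' (φ z)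
  factor X Xx≡Xy = (λ z' → X (punchIn y z')) , λ z → lift z (punchIn-identify x y x≢y z)
    where
    lift : ∀ z → punchIn y (φ z) ≡ z ⊎ (z ≡ y × punchIn y (φ z) ≡ x) → X z ≡ X (punchIn y (φ z))
    lift z (inj₁ p)          = cong X (sym p)
    lift z (inj₂ (refl , p)) = trans (sym Xx≡Xy) (cong X (sym p))
  e∈e : T (singleton e e)
  e∈e = ≡⇒T (==-refl e)
  φ-ker : ∀ u v → φ u ≡ φ v → UWalk D (λ f → T (singleton e f)) u v
  φ-ker u v φu≡φv with punchIn-identify x y x≢y u | punchIn-identify x y x≢y v
  ... | inj₁ p | inj₁ q = subst (UWalk D _ u) (trans (sym p) (trans (cong (punchIn y) φu≡φv) q)) nil
  ... | inj₁ p | inj₂ (refl , q) =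
    subst (λ z → UWalk D _ z y) (trans (sym q) (trans (cong (punchIn y) (sym φu≡φv)) p)) (fwd e e∈e nil)
  ... | inj₂ (refl , p) | inj₁ q =
    subst (UWalk D _ y) (trans (sym p) (trans (cong (punchIn y) φu≡φv) q)) (bwd e e∈e nil)
  ... | inj₂ (refl , _) | inj₂ (refl , _) = nil

contractionMap-id : ∀ D (A : EdgeSet D) → (∀ e → A e ≡ false) → ContractionMap D D A
contractionMap-id D A A-empty = record
  { φ = λ z → z ; ψ = λ e → e ; ψ-inj = λ p → p ; ψ-onto = λ e _ → e , refl
  ; tail-comm = λ _ → refl ; head-comm = λ _ → refl
  ; collapse = λ e e∈A → ⊥-elim (true≢false (trans (sym e∈A) (A-empty e)))
  ; factor = λ X _ → X , λ _ → refl }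

record ContractedMinor (n m : ℕ) (t h : Fin m → Fin n) (A : Fin m → Bool) : Set where
  field
    D'       : Digraph
    minor    : CutMinor (digraph n m t h) D'
    map      : ContractionMap (digraph n m t h) D' A
    shrinks  : nE D' ≤ m
    shrinks⁺ : ∀ e → A e ≡ true → nE D' < m

contract-all : ∀ n m (t h : Fin m → Fin n) (A : Fin m → Bool) → ContractedMinor n m t h A
contract-all n zero t h A = record
  { D' = digraph n zero t h ; minor = ε ; map = contractionMap-id _ A (λ ()) ; shrinks = ≤-refl ; shrinks⁺ = λ () }
contract-all n (suc m) t h A with any? (λ e → A e ≟B true)
... | no A-empty = record
  { D' = digraph n (suc m) t h ; minor = ε
  ; map = contractionMap-id _ A (λ e → ¬T⇒≡false λ e∈A → A-empty (e , T⇒≡ e∈A))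
  ; shrinks = ≤-refl ; shrinks⁺ = λ e e∈A → ⊥-elim (A-empty (e , e∈A)) }
... | yes (e , e∈A) = record
  { D' = D' ; minor = inj₁ (singleton e , EdgeContraction.contraction first) ◅ minor
  ; map = map′ ; shrinks = m≤n⇒m≤1+n shrinks ; shrinks⁺ = λ _ _ → s≤s shrinks }
  where
  first = contract-edge n m t h e
  φ₁ = EdgeContraction.φ first
  rest = contract-all (EdgeContraction.n′ first) m
           (λ i → φ₁ (t (punchIn e i))) (λ i → φ₁ (h (punchIn e i))) (λ i → A (punchIn e i))
  open ContractedMinor rest
  module R = ContractionMap map
  ψ-onto : ∀ f → A f ≡ false → Σ (E D') λ e' → punchIn e (R.ψ e') ≡ f
  ψ-onto f f∉A with punchIn-covers e f (λ f≡e → true≢false (trans (sym e∈A) (trans (cong A (sym f≡e)) f∉A)))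
  ... | i , refl with R.ψ-onto i f∉A
  ...   | e' , refl = e' , refl
  collapse : ∀ f → A f ≡ true → R.φ (φ₁ (t f)) ≡ R.φ (φ₁ (h f))
  collapse f f∈A with f ≟F e
  ... | yes refl = cong R.φ (EdgeContraction.collapse first)
  ... | no f≢e with punchIn-covers e f f≢e
  ...   | i , refl = R.collapse i f∈A
  factor : ∀ (X : Fin n → Bool) → (∀ f → A f ≡ true → X (t f) ≡ X (h f)) →
    Σ (V D' → Bool) λ X' → ∀ z → X z ≡ X' (R.φ (φ₁ z))
  factor X X-inv with EdgeContraction.factor first X (X-inv e e∈A)
  ... | X₁ , X≗X₁ with R.factor X₁ (λ i i∈A → trans (sym (X≗X₁ _)) (trans (X-inv (punchIn e i) i∈A) (X≗X₁ _)))
  ...   | X' , X₁≗X' = X' , λ z → trans (X≗X₁ z) (X₁≗X' (φ₁ z))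
  map′ : ContractionMap (digraph n (suc m) t h) D' A
  map′ = record
    { φ = λ z → R.φ (φ₁ z) ; ψ = λ e' → punchIn e (R.ψ e')
    ; ψ-inj = λ p → R.ψ-inj (punchIn-injective e _ _ p) ; ψ-onto = ψ-onto
    ; tail-comm = R.tail-comm ; head-comm = R.head-comm ; collapse = collapse ; factor = factor }

fewer-edges⇒¬Iso : ∀ D D' → nE D' < nE D → ¬ Iso D D'
fewer-edges⇒¬Iso D D' lt iso with pigeonhole lt (Bijection.to (Iso.ψ iso))
... | i , j , i<j , ψi≡ψj = FinP.<-irrefl (Bijection.injective (Iso.ψ iso) ψi≡ψj) i<j

fewer-vertices⇒¬Iso : ∀ D D' → nV D' < nV D → ¬ Iso D D'
fewer-vertices⇒¬Iso D D' lt iso with pigeonhole lt (Bijection.to (Iso.φ iso))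
... | i , j , i<j , φi≡φj = FinP.<-irrefl (Bijection.injective (Iso.φ iso) φi≡φj) i<j

-- Consequences of minimality

OddOnBondsAvoiding : (D : Digraph) → EdgeSet D → EdgeSet D → Set
OddOnBondsAvoiding D A J =
  ∀ X → DirectedBond D X → (∀ e → A e ≡ true → cut D X e ≡ false) → Odd (count (λ e → J e ∧ cut D X e))

-- Contracting a nonempty A gives a proper cut minor; its odd dijoin, pulled back along the
-- edge embedding, is odd on every directed bond of D that survives the contraction.
oddOnBondsAvoiding : ∀ D → MinimalObstruction D → (A : EdgeSet D) → (Σ (E D) λ e → A e ≡ true) →
  Σ (EdgeSet D) (OddOnBondsAvoiding D A)
oddOnBondsAvoiding D (_ , minors-ok) A (e , e∈A) = pull-back (minors-ok D' (minor , fewer-edges⇒¬Iso D D' (shrinks⁺ e e∈A)))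
  where
  open ContractedMinor (contract-all (nV D) (nE D) (tail D) (head D) A)
  open ContractionMap map
  pull-back : HasOddDijoin D' → Σ (EdgeSet D) (OddOnBondsAvoiding D A)
  pull-back (J' , J'-odd) =
    pushforward ψ J' , λ X db avoid → transport-odd ψ-inj db (contraction-transport map X db avoid) J' J'-odd

inDirectedBond : ∀ D → MinimalObstruction D → ∀ e → ¬ (∀ X → DirectedBond D X → cut D X e ≡ false)
inDirectedBond D mo e e∉bonds with oddOnBondsAvoiding D mo (singleton e) (e , ==-refl e)
... | J , J-odd = proj₁ mo (J , λ X db → J-odd X db λ f f≡e →
  subst (λ g → cut D X g ≡ false) (sym (==⇒≡ f e f≡e)) (e∉bonds X db))

module _ (n m : ℕ) (t h : Fin (suc m) → Fin n) (e : Fin (suc m)) where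
  private
    D  = digraph n (suc m) t h
    D′ = digraph n m (λ i → t (punchIn e i)) (λ i → h (punchIn e i))

  deleteEdge : Deletable D e → DeleteEdge D e D′
  deleteEdge del = record
    { deletable = del ; φ = ⤖-id (Fin n) ; ψ = punchIn e ; ψ-inj = punchIn-injective e _ _
    ; ψ-out = punchInᵢ≢i e ; ψ-onto = punchIn-covers e
    ; tail-comm = λ _ → refl ; head-comm = λ _ → refl }

  -- The x–y path P that makes e deletable crosses every directed cut containing e, and
  -- does so along another edge: this keeps the cut nonempty and its minimality intact.
  deletion-transport : Deletable D e → ∀ X → DirectedBond D X → BondTransport D D′ (punchIn e) X
  deletion-transport (_ , P) X ((_ , (g , g∈X) , _) , dir) = record
    { X' = X ; tail-agree = λ _ → refl ; head-agree = λ _ → refl ; crossing = crossing ; lift-subcut = lift-subcut }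
    where
    crossing : Σ (Fin m) λ i → T (cut D X (punchIn e i))
    crossing with g ≟F e
    ... | no g≢e with punchIn-covers e g g≢e
    ...   | i , refl = i , g∈X
    crossing | yes refl
      with dwalk-leaves D X _ P (T⇒≡ (proj₁ (dir g g∈X))) (T-not⇒≡false (proj₂ (dir g g∈X)))
    ... | f , f≢e , Xt , Xh with punchIn-covers e f f≢e
    ...   | i , refl = i , subst T (sym (cong₂ _xor_ Xt Xh)) tt
    lift-subcut : ∀ (Z' : Fin n → Bool) → NonemptyE {D′} (cut D′ Z') → _⊆E_ {D′} (cut D′ Z') (cut D′ X) →
      Σ (Fin n → Bool) λ Z → _⊆E_ {D} (cut D Z) (cut D X) × (∀ i → cut D Z (punchIn e i) ≡ cut D′ Z' i)
    lift-subcut Z _ Z⊆X = Z , Z⊆X′ , λ _ → refl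
      where
      Z⊆X-off-e : ∀ f → f ≢ e → T (cut D Z f) → T (cut D X f)
      Z⊆X-off-e f f≢e f∈Z with punchIn-covers e f f≢e
      ... | i , refl = Z⊆X i f∈Z
      Z⊆X′ : _⊆E_ {D} (cut D Z) (cut D X)
      Z⊆X′ f f∈Z with f ≟F e
      ... | no f≢e  = Z⊆X-off-e f f≢e f∈Z
      ... | yes refl with dwalk-crossing-subcut D X Z _ dir P Z⊆X-off-e (xor≡true⇒≢ _ _ (T⇒≡ f∈Z))
      ...   | Xt , Xh = subst T (sym (cong₂ _xor_ Xt Xh)) tt

¬deletable : ∀ D → MinimalObstruction D → ∀ e → ¬ Deletable D e
¬deletable D = go (nE D) (tail D) (head D)
  where
  go : ∀ m (t h : Fin m → Fin (nV D)) → MinimalObstruction (digraph (nV D) m t h) →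
    ∀ e → ¬ Deletable (digraph (nV D) m t h) e
  go (suc m) t h (no-dijoin , minors-ok) e del
    with minors-ok _ (inj₂ (inj₁ (e , deleteEdge (nV D) m t h e del)) ◅ ε , fewer-edges⇒¬Iso _ _ ≤-refl)
  ... | J' , J'-odd = no-dijoin (pushforward (punchIn e) J' , λ X db →
    transport-odd (punchIn-injective e _ _) db (deletion-transport (nV D) m t h e del X db) J' J'-odd)

module _ (n m : ℕ) (t h : Fin m → Fin (suc n)) (v : Fin (suc n)) (isolated : Isolated (digraph (suc n) m t h) v) where
  private
    D = digraph (suc n) m t h
    t′ h′ : Fin m → Fin n
    t′ e = punchOut {i = v} {j = t e} (λ v≡t → proj₁ (isolated e) (sym v≡t))
    h′ e = punchOut {i = v} {j = h e} (λ v≡h → proj₂ (isolated e) (sym v≡h))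
    D′ = digraph n m t′ h′

  deleteVertex : DeleteVertex D v D′
  deleteVertex = record
    { isolated = isolated ; φ = punchIn v ; φ-inj = punchIn-injective v _ _ ; φ-out = punchInᵢ≢i v
    ; φ-onto = λ u u≢v → punchOut {i = v} {j = u} (λ v≡u → u≢v (sym v≡u)) , punchIn-punchOut _
    ; ψ = ⤖-id (Fin m)
    ; tail-comm = λ _ → sym (punchIn-punchOut _) ; head-comm = λ _ → sym (punchIn-punchOut _) }

  vertexDeletion-transport : ∀ X → DirectedBond D X → BondTransport D D′ (λ e → e) X
  vertexDeletion-transport X ((_ , crossing , _) , _) = record
    { X' = λ z → X (punchIn v z)
    ; tail-agree = λ _ → cong X (punchIn-punchOut _) ; head-agree = λ _ → cong X (punchIn-punchOut _)
    ; crossing = crossing ; lift-subcut = lift-subcut }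
    where
    lift-subcut : ∀ (Z' : Fin n → Bool) → NonemptyE {D′} (cut D′ Z') →
      _⊆E_ {D′} (cut D′ Z') (cut D′ (λ z → X (punchIn v z))) →
      Σ (Fin (suc n) → Bool) λ Z → _⊆E_ {D} (cut D Z) (cut D X) × (∀ e → cut D Z e ≡ cut D′ Z' e)
    lift-subcut Z' _ Z'⊆X' = Z , (λ e e∈Z → subst T (cut-X e) (Z'⊆X' e (subst T (cut-Z e) e∈Z))) , cut-Z
      where
      Z : Fin (suc n) → Bool
      Z z with z ≟F v
      ... | yes _   = false
      ... | no z≢v  = Z' (punchOut {i = v} {j = z} (λ v≡z → z≢v (sym v≡z)))
      Z-off-v : ∀ z (z≢v : z ≢ v) → Z z ≡ Z' (punchOut {i = v} {j = z} (λ v≡z → z≢v (sym v≡z)))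
      Z-off-v z z≢v with z ≟F v
      ... | yes z≡v = ⊥-elim (z≢v z≡v)
      ... | no _    = cong Z' (punchOut-cong v refl)
      cut-Z : ∀ e → cut D Z e ≡ cut D′ Z' e
      cut-Z e = cong₂ _xor_ (Z-off-v (t e) (proj₁ (isolated e))) (Z-off-v (h e) (proj₂ (isolated e)))
      cut-X : ∀ e → cut D′ (λ z → X (punchIn v z)) e ≡ cut D X e
      cut-X e = cong₂ _xor_ (cong X (punchIn-punchOut _)) (cong X (punchIn-punchOut _))

¬isolated : ∀ D → MinimalObstruction D → ∀ v → ¬ Isolated D v
¬isolated D = go (nV D) (tail D) (head D)
  where
  go : ∀ n (t h : Fin (nE D) → Fin n) → MinimalObstruction (digraph n (nE D) t h) →
    ∀ v → ¬ Isolated (digraph n (nE D) t h) v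
  go (suc n) t h (no-dijoin , minors-ok) v isolated
    with minors-ok _ (inj₂ (inj₂ (v , deleteVertex n (nE D) t h v isolated)) ◅ ε , fewer-vertices⇒¬Iso _ _ ≤-refl)
  ... | J' , J'-odd = no-dijoin (pushforward (λ e → e) J' , λ X db →
    transport-odd (λ p → p) db (vertexDeletion-transport n (nE D) t h v isolated X db) J' J'-odd)

incidentEdge : ∀ D → MinimalObstruction D → ∀ u → Σ (E D) λ e → tail D e ≡ u ⊎ head D e ≡ u
incidentEdge D mo u with any? (λ e → (tail D e ≟F u) ⊎-dec (head D e ≟F u))
... | yes incident = incident
... | no  none     = ⊥-elim (¬isolated D mo u λ e → (λ t≡u → none (e , inj₁ t≡u)) , (λ h≡u → none (e , inj₂ h≡u)))

-- A directed cut containing e would have to be crossed back by the walk from head e to tail e.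
acyclic : ∀ D → MinimalObstruction D → Acyclic D
acyclic D mo e back = inDirectedBond D mo e λ X (_ , dir) → ¬T⇒≡false λ e∈X →
  let (Xt , ¬Xh) = dir e e∈X in
  true≢false (trans (sym (T⇒≡ Xt)) (dwalk-staysOutside D X _ dir back (T-not⇒≡false ¬Xh)))

oriented : ∀ D → MinimalObstruction D → Oriented D
oriented D mo = loopless , no-parallel , no-antiparallel
  where
  loopless : ∀ e → tail D e ≢ head D e
  loopless e t≡h = acyclic D mo e (subst (DWalk D _ (head D e)) (sym t≡h) nil)
  no-parallel : ∀ e f → e ≢ f → ¬ (tail D e ≡ tail D f × head D e ≡ head D f)
  no-parallel e f e≢f (t≡t , h≡h) = ¬deletable D mo e
    (loopless e , subst₂ (DWalk D _) (sym t≡t) (sym h≡h) (step f (λ f≡e → e≢f (sym f≡e)) nil))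
  no-antiparallel : ∀ e f → ¬ (tail D e ≡ head D f × head D e ≡ tail D f)
  no-antiparallel e f (t≡h , h≡t) = acyclic D mo e (subst₂ (DWalk D _) (sym h≡t) (sym t≡h) (step f tt nil))

Fin≤2-covered : ∀ {n} → n ≤ 2 → (a b c : Fin n) → a ≢ b → c ≡ a ⊎ c ≡ b
Fin≤2-covered {suc zero}       _ F.zero F.zero _ a≢b = ⊥-elim (a≢b refl)
Fin≤2-covered {suc (suc zero)} _ F.zero F.zero _ a≢b = ⊥-elim (a≢b refl)
Fin≤2-covered {suc (suc zero)} _ (F.suc F.zero) (F.suc F.zero) _ a≢b = ⊥-elim (a≢b refl)
Fin≤2-covered {suc (suc zero)} _ F.zero (F.suc F.zero) F.zero _ = inj₁ refl
Fin≤2-covered {suc (suc zero)} _ F.zero (F.suc F.zero) (F.suc F.zero) _ = inj₂ refl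
Fin≤2-covered {suc (suc zero)} _ (F.suc F.zero) F.zero F.zero _ = inj₂ refl
Fin≤2-covered {suc (suc zero)} _ (F.suc F.zero) F.zero (F.suc F.zero) _ = inj₁ refl
Fin≤2-covered {suc (suc (suc n))} (s≤s (s≤s ())) _ _ _ _

-- With at most two vertices an oriented digraph has at most one edge, so taking all edges
-- meets every (nonempty) directed bond exactly once.
oriented≤2⇒hasOddDijoin : ∀ n m (t h : Fin m → Fin n) → n ≤ 2 → Oriented (digraph n m t h) →
  HasOddDijoin (digraph n m t h)
oriented≤2⇒hasOddDijoin n zero t h _ _ = (λ _ → true) , λ { X ((_ , (() , _) , _) , _) }
oriented≤2⇒hasOddDijoin n (suc zero) t h _ _ =
  (λ _ → true) , λ { X ((_ , (F.zero , e∈X) , _) , _) → subst (λ b → Odd (bit b + 0)) (sym (T⇒≡ e∈X)) refl }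
oriented≤2⇒hasOddDijoin n (suc (suc m)) t h n≤2 (loopless , no-parallel , no-antiparallel) =
  ⊥-elim (two-edges (ends (t e₁)) (ends (h e₁)))
  where
  e₀ e₁ : Fin (suc (suc m))
  e₀ = F.zero
  e₁ = F.suc F.zero
  ends : ∀ z → z ≡ t e₀ ⊎ z ≡ h e₀
  ends z = Fin≤2-covered n≤2 (t e₀) (h e₀) z (loopless e₀)
  two-edges : t e₁ ≡ t e₀ ⊎ t e₁ ≡ h e₀ → h e₁ ≡ t e₀ ⊎ h e₁ ≡ h e₀ → ⊥
  two-edges (inj₁ p) (inj₁ q) = loopless e₁ (trans p (sym q))
  two-edges (inj₁ p) (inj₂ q) = no-parallel e₀ e₁ (λ ()) (sym p , sym q)
  two-edges (inj₂ p) (inj₁ q) = no-antiparallel e₀ e₁ (sym q , sym p)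
  two-edges (inj₂ p) (inj₂ q) = loopless e₁ (trans p (sym q))

threeVertices : ∀ D → MinimalObstruction D → 2 < nV D
threeVertices D mo with 2 <? nV D
... | yes 2<n = 2<n
... | no  2≮n = ⊥-elim (proj₁ mo (oriented≤2⇒hasOddDijoin (nV D) (nE D) (tail D) (head D) (≮⇒≥ 2≮n) (oriented D mo)))

-- Separations at a vertex

-- Every edge between `side` and its complement has p as its end outside `side`; p may lie in
-- `side` when no edge crosses.
record Separation (D : Digraph) (p : V D) : Set where
  field
    side        : V D → Bool
    leave-to-p  : ∀ e → side (tail D e) ≡ true → side (head D e) ≡ false → head D e ≡ p
    enter-from-p : ∀ e → side (head D e) ≡ true → side (tail D e) ≡ false → tail D e ≡ p
    inner       : V D
    inner-in    : side inner ≡ true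
    outer       : V D
    outer-out   : side outer ≡ false
    outer≢p     : outer ≢ p

-- Split the edges into those touching `side` and the rest; both classes are nonempty, so
-- each has an odd set for the bonds avoiding it. Every directed bond avoids one class,
-- because its trace on the first class is again a cut, so the two odd sets glue.
module _ (D : Digraph) (mo : MinimalObstruction D) {p : V D} (sep : Separation D p) where
  open Separation sep

  private
    near : EdgeSet D
    near e = side (tail D e) ∨ side (head D e)

    far : EdgeSet D
    far e = not (near e)

    near-edge : Σ (E D) λ e → near e ≡ true
    near-edge with incidentEdge D mo inner
    ... | e , inj₁ t≡u = e , subst (λ b → b ∨ side (head D e) ≡ true) (sym (trans (cong side t≡u) inner-in)) refl
    ... | e , inj₂ h≡u = e , ∨-true-right (side (tail D e)) (trans (cong side h≡u) inner-in)

    far-edge : Σ (E D) λ e → far e ≡ true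
    far-edge with incidentEdge D mo outer
    ... | e , inj₁ t≡w with side (head D e) in h-in
    ...   | true  = ⊥-elim (outer≢p (trans (sym t≡w) (enter-from-p e h-in (trans (cong side t≡w) outer-out))))
    ...   | false = e , cong₂ (λ a b → not (a ∨ b)) (trans (cong side t≡w) outer-out) h-in
    far-edge | e , inj₂ h≡w with side (tail D e) in t-in
    ...   | true  = ⊥-elim (outer≢p (trans (sym h≡w) (leave-to-p e t-in (trans (cong side h≡w) outer-out))))
    ...   | false = e , cong₂ (λ a b → not (a ∨ b)) t-in (trans (cong side h≡w) outer-out)

    module _ (X : V D → Bool) where
      nearPart : V D → Bool
      nearPart z = if side z then X z else X p

      nearPart-tail : ∀ e → near e ≡ true → nearPart (tail D e) ≡ X (tail D e)
      nearPart-tail e e-near with side (tail D e) in t-in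
      ... | true  = refl
      ... | false = cong X (sym (enter-from-p e e-near t-in))

      nearPart-head : ∀ e → near e ≡ true → nearPart (head D e) ≡ X (head D e)
      nearPart-head e e-near with side (head D e) in h-in
      ... | true  = refl
      ... | false = cong X (sym (leave-to-p e (∨-true-left (side (tail D e)) e-near refl) h-in))

      cut-nearPart-near : ∀ e → near e ≡ true → cut D nearPart e ≡ cut D X e
      cut-nearPart-near e e-near = cong₂ _xor_ (nearPart-tail e e-near) (nearPart-head e e-near)

      cut-nearPart-far : ∀ e → near e ≡ false → cut D nearPart e ≡ false
      cut-nearPart-far e e-far with ∨-false (side (tail D e)) e-far
      ... | t-out , h-out rewrite t-out | h-out = xor-same (X p)

    bond-avoids-near : ∀ X → DirectedBond D X → (Σ (E D) λ f → (far f ∧ cut D X f) ≡ true) →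
      ∀ e → near e ≡ true → cut D X e ≡ false
    bond-avoids-near X ((_ , _ , minimal) , _) (f , f-far∈X) e e-near = ¬T⇒≡false λ e∈X →
      subst T (cut-nearPart-far X f f-near≡false) (X⊆near e∈X f (≡⇒T (∧-true-right (far f) f-far∈X)))
      where
      f-near≡false : near f ≡ false
      f-near≡false with near f | ∧-true-left (far f) f-far∈X
      ... | false | _ = refl
      near⊆X : _⊆E_ {D} (cut D (nearPart X)) (cut D X)
      near⊆X g g∈near with near g in g-near
      ... | true  = subst T (cut-nearPart-near X g g-near) g∈near
      ... | false = ⊥-elim (subst T (cut-nearPart-far X g g-near) g∈near)
      X⊆near : T (cut D X e) → _⊆E_ {D} (cut D X) (cut D (nearPart X))
      X⊆near e∈X = minimal (cut D (nearPart X)) (nearPart X , λ _ → refl)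
                 (e , subst T (sym (cut-nearPart-near X e e-near)) e∈X) near⊆X

    J-near = oddOnBondsAvoiding D mo far far-edge
    J-far  = oddOnBondsAvoiding D mo near near-edge

    glued : EdgeSet D
    glued e = if near e then proj₁ J-near e else proj₁ J-far e

    count-on-cut : ∀ X (K : EdgeSet D) → (∀ e → cut D X e ≡ true → glued e ≡ K e) →
      count (λ e → glued e ∧ cut D X e) ≡ count (λ e → K e ∧ cut D X e)
    count-on-cut X K agree = count-cong _ _ λ e → on-cut e
      where
      on-cut : ∀ e → (glued e ∧ cut D X e) ≡ (K e ∧ cut D X e)
      on-cut e with cut D X e in e∈X
      ... | true  = cong (_∧ true) (agree e e∈X)
      ... | false = trans (∧-zeroʳ (glued e)) (sym (∧-zeroʳ (K e)))

  separation-oddDijoin : HasOddDijoin D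
  separation-oddDijoin = glued , odd
    where
    odd : OddDijoin D glued
    odd X db with any? (λ e → (far e ∧ cut D X e) ≟B true)
    ... | yes meets-far =
      subst Odd (sym (count-on-cut X (proj₁ J-far) agree)) (proj₂ J-far X db avoids-near)
      where
      avoids-near = bond-avoids-near X db meets-far
      agree : ∀ e → cut D X e ≡ true → glued e ≡ proj₁ J-far e
      agree e e∈X with near e in e-near
      ... | false = refl
      ... | true  = ⊥-elim (true≢false (trans (sym e∈X) (avoids-near e e-near)))
    ... | no avoids =
      subst Odd (sym (count-on-cut X (proj₁ J-near) agree)) (proj₂ J-near X db avoids-far)
      where
      avoids-far : ∀ e → far e ≡ true → cut D X e ≡ false
      avoids-far e e-far = ¬T⇒≡false λ e∈X →
        avoids (e , subst (λ b → (b ∧ cut D X e) ≡ true) (sym e-far) (T⇒≡ e∈X))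
      agree : ∀ e → cut D X e ≡ true → glued e ≡ proj₁ J-near e
      agree e e∈X with near e in e-near
      ... | true  = refl
      ... | false = ⊥-elim (true≢false (trans (sym e∈X) (avoids-far e (cong not e-near))))

¬separation : ∀ D → MinimalObstruction D → ∀ {p} → ¬ Separation D p
¬separation D mo sep = proj₁ mo (separation-oddDijoin D mo sep)

-- Each non-closing step adds an element, so after n steps the iteration is closed.
module _ {n} (step : (Fin n → Bool) → Fin n → Bool) (inflationary : ∀ S z → S z ≡ true → step S z ≡ true)
         (P : (Fin n → Bool) → Set) (step-preserves : ∀ S → P S → P (step S)) where

  record ClosedAbove (S : Fin n → Bool) : Set where
    field
      closure  : Fin n → Bool
      P-closure : P closure
      closed   : ∀ z → step closure z ≡ true → closure z ≡ true
      above    : ∀ z → S z ≡ true → closure z ≡ true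

  private
    iterate : ∀ fuel S → P S → n < count S + fuel → ClosedAbove S
    iterate zero S PS n<|S| = ⊥-elim (≤⇒≯ (count≤ S) (subst (n <_) (+-identityʳ _) n<|S|))
    iterate (suc fuel) S PS n<|S|+fuel with any? (λ z → (step S z ≟B true) ×-dec (S z ≟B false))
    ... | no closed = record
      { closure = S ; P-closure = PS ; above = λ _ z∈S → z∈S
      ; closed = λ z z∈stepS → ¬-not (λ z∉S → closed (z , z∈stepS , z∉S)) }
    ... | yes (z , z∈stepS , z∉S) = record
      { ClosedAbove rest ; above = λ y y∈S → ClosedAbove.above rest y (inflationary S y y∈S) }
      where
      rest = iterate fuel (step S) (step-preserves S PS)
        (≤-trans (subst (n <_) (+-suc (count S) fuel) n<|S|+fuel)
                 (+-mono-≤ (count-strictMono S (step S) (inflationary S) z z∈stepS z∉S) ≤-refl))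

  closedAbove : ∀ S → P S → ClosedAbove S
  closedAbove S PS = iterate (suc n) S PS (subst (n <_) (sym (+-suc (count S) n)) (s≤s (m≤n+m n (count S))))

∨-true⇒⊎ : ∀ a {b} → a ∨ b ≡ true → a ≡ true ⊎ b ≡ true
∨-true⇒⊎ true  _ = inj₁ refl
∨-true⇒⊎ false p = inj₂ p

-- Ok is the property of edges that the walks record; `allowed` decides a part of it.
module Reach (D : Digraph) (allowed : E D → Bool) (Ok : E D → Set) (sound : ∀ e → allowed e ≡ true → Ok e)
             (u : V D) where

  grow : (V D → Bool) → V D → Bool
  grow S z = S z ∨ anyFin λ e →
    allowed e ∧ ((tail D e == z ∧ S (head D e)) ∨ (head D e == z ∧ S (tail D e)))

  Reached : (V D → Bool) → Set
  Reached S = ∀ z → S z ≡ true → UWalk D Ok u z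

  grow-reached : ∀ S → Reached S → Reached (grow S)
  grow-reached S reached z z∈grow with S z in z∈S
  ... | true  = reached z z∈S
  ... | false with anyFin-witness _ z∈grow
  ...   | e , fires with ∨-true⇒⊎ (tail D e == z ∧ S (head D e)) (∧-true-right (allowed e) fires)
  ...     | inj₁ q = subst (UWalk D Ok u) (==⇒≡ _ _ (∧-true-left _ q))
                       (reached _ (∧-true-right (tail D e == z) q) ++ᵘ bwd e (sound e (∧-true-left _ fires)) nil)
  ...     | inj₂ q = subst (UWalk D Ok u) (==⇒≡ _ _ (∧-true-left _ q))
                       (reached _ (∧-true-right (head D e == z) q) ++ᵘ fwd e (sound e (∧-true-left _ fires)) nil)

  grow-inflationary : ∀ S z → S z ≡ true → grow S z ≡ true
  grow-inflationary S z z∈S rewrite z∈S = refl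

  private
    reachClosure : ClosedAbove grow grow-inflationary Reached grow-reached (λ z → z == u)
    reachClosure = closedAbove grow grow-inflationary Reached grow-reached (λ z → z == u)
                     λ z z≡u → subst (UWalk D Ok u) (sym (==⇒≡ z u z≡u)) nil

  reach : V D → Bool
  reach = ClosedAbove.closure reachClosure

  reach-walk : Reached reach
  reach-walk = ClosedAbove.P-closure reachClosure

  reach-start : reach u ≡ true
  reach-start = ClosedAbove.above reachClosure u (==-refl u)

  reach-head : ∀ e → allowed e ≡ true → reach (tail D e) ≡ true → reach (head D e) ≡ true
  reach-head e ok t∈ = ClosedAbove.closed reachClosure (head D e)
    (∨-true-right (reach (head D e)) (anyFin-intro _ e fires))
    where
    fires : allowed e ∧ ((tail D e == head D e ∧ reach (head D e)) ∨ (head D e == head D e ∧ reach (tail D e))) ≡ true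
    fires rewrite ok | ==-refl (head D e) | t∈ = ∨-zeroʳ _

  reach-tail : ∀ e → allowed e ≡ true → reach (head D e) ≡ true → reach (tail D e) ≡ true
  reach-tail e ok h∈ = ClosedAbove.closed reachClosure (tail D e)
    (∨-true-right (reach (tail D e)) (anyFin-intro _ e fires))
    where
    fires : allowed e ∧ ((tail D e == tail D e ∧ reach (head D e)) ∨ (head D e == tail D e ∧ reach (tail D e))) ≡ true
    fires rewrite ok | ==-refl (tail D e) | h∈ = refl

-- Connectivity

connected : ∀ D → MinimalObstruction D → Connected D
connected D mo u w = reached-or-separated (reach w) refl
  where
  open Reach D (λ _ → true) (λ _ → ⊤) (λ _ _ → tt) u
  separation : reach w ≡ false → Separation D u
  separation w∉ = record
    { side = reach
    ; leave-to-p   = λ e t∈ h∉ → ⊥-elim (true≢false (trans (sym (reach-head e refl t∈)) h∉))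
    ; enter-from-p = λ e h∈ t∉ → ⊥-elim (true≢false (trans (sym (reach-tail e refl h∈)) t∉))
    ; inner = u ; inner-in = reach-start ; outer = w ; outer-out = w∉
    ; outer≢p = λ { refl → true≢false (trans (sym reach-start) w∉) } }
  reached-or-separated : ∀ b → reach w ≡ b → UWalk D (λ _ → ⊤) u w
  reached-or-separated true  w∈ = reach-walk w w∈
  reached-or-separated false w∉ = ⊥-elim (¬separation D mo (separation w∉))

AvoidsVertex : (D : Digraph) → V D → E D → Set
AvoidsVertex D v e = tail D e ≢ v × head D e ≢ v

uwalk-avoids : ∀ D v {u z} → UWalk D (AvoidsVertex D v) u z → u ≢ v → z ≢ v
uwalk-avoids D v nil             u≢v = u≢v
uwalk-avoids D v (fwd e avoid w) _   = uwalk-avoids D v w (proj₂ avoid)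
uwalk-avoids D v (bwd e avoid w) _   = uwalk-avoids D v w (proj₁ avoid)

not∧not≡false⇒⊎ : ∀ a b → (not a ∧ not b) ≡ false → a ≡ true ⊎ b ≡ true
not∧not≡false⇒⊎ true  b     _ = inj₁ refl
not∧not≡false⇒⊎ false true  _ = inj₂ refl

module _ (D : Digraph) (v : V D) where
  avoidsVertex? : E D → Bool
  avoidsVertex? e = not (tail D e == v) ∧ not (head D e == v)

  avoidsVertex-sound : ∀ e → avoidsVertex? e ≡ true → AvoidsVertex D v e
  avoidsVertex-sound e p =
    (λ t≡v → ≢v (tail D e) t≡v (∧-true-left (not (tail D e == v)) p)) ,
    (λ h≡v → ≢v (head D e) h≡v (∧-true-right (not (tail D e == v)) p))
    where
    ≢v : ∀ z → z ≡ v → not (z == v) ≢ true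
    ≢v z refl p = true≢false (trans (sym p) (cong not (==-refl z)))

connected-avoiding : ∀ D → MinimalObstruction D → ∀ (v u w : V D) → u ≢ v → w ≢ v →
  UWalk D (AvoidsVertex D v) u w
connected-avoiding D mo v u w u≢v w≢v = reached-or-separated (reach w) refl
  where
  open Reach D (avoidsVertex? D v) (AvoidsVertex D v) (avoidsVertex-sound D v) u
  v∉ : reach v ≡ false
  v∉ = ¬T⇒≡false λ v∈ → uwalk-avoids D v (reach-walk v (T⇒≡ v∈)) u≢v refl
  leave-to-v : ∀ e → reach (tail D e) ≡ true → reach (head D e) ≡ false → head D e ≡ v
  leave-to-v e t∈ h∉ with avoidsVertex? D v e in allowed
  ... | true  = ⊥-elim (true≢false (trans (sym (reach-head e allowed t∈)) h∉))
  ... | false with not∧not≡false⇒⊎ (tail D e == v) (head D e == v) allowed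
  ...   | inj₁ t≡v = ⊥-elim (true≢false (trans (sym t∈) (trans (cong reach (==⇒≡ _ _ t≡v)) v∉)))
  ...   | inj₂ h≡v = ==⇒≡ _ _ h≡v
  enter-from-v : ∀ e → reach (head D e) ≡ true → reach (tail D e) ≡ false → tail D e ≡ v
  enter-from-v e h∈ t∉ with avoidsVertex? D v e in allowed
  ... | true  = ⊥-elim (true≢false (trans (sym (reach-tail e allowed h∈)) t∉))
  ... | false with not∧not≡false⇒⊎ (tail D e == v) (head D e == v) allowed
  ...   | inj₁ t≡v = ==⇒≡ _ _ t≡v
  ...   | inj₂ h≡v = ⊥-elim (true≢false (trans (sym h∈) (trans (cong reach (==⇒≡ _ _ h≡v)) v∉)))
  separation : reach w ≡ false → Separation D v
  separation w∉ = record
    { side = reach ; leave-to-p = leave-to-v ; enter-from-p = enter-from-v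
    ; inner = u ; inner-in = reach-start ; outer = w ; outer-out = w∉ ; outer≢p = w≢v }
  reached-or-separated : ∀ b → reach w ≡ b → UWalk D (AvoidsVertex D v) u w
  reached-or-separated true  w∈ = reach-walk w w∈
  reached-or-separated false w∉ = ⊥-elim (¬separation D mo (separation w∉))

lemma4p6 : (D : Digraph) → MinimalObstruction D →
    TwoVertexConnected D × Oriented D × Acyclic D × TransitivelyReduced D
lemma4p6 D mo =
  (threeVertices D mo , connected D mo , connected-avoiding D mo) ,
  oriented D mo , acyclic D mo , ¬deletable D mo
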